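{- Let $S,T\in\{0,1,2\}^*$ and $x,y,G_x$ as in the context, and let $p$ be a path from $x$ to $y$ in $G_x$. If $p$ visits a vertex $x[i..j]$ with $x[i..j]\in 01*\overline{10^k}$ for some integer $k\ge1$, then for every $k'\in[1..k-1]$ the path $p$ also visits $x[i..j-k']$. Symmetrically, if $p$ visits a vertex $x[i..j]$ with $x[i..j]\in 0^k1*\overline{10}$ for some integer $k\ge1$, then for every $k'\in[1..k-1]$ the path $p$ also visits $x[i+k'..j]$.
   Context: Alphabet $\{0,1\}$, $\overline{0}=1$, $\overline{1}=0$; $\overline{X}$ symbolwise (so $\overline{10^k}=01^k$), $\overleftarrow{X}=\overline{X[|X|]}\cdots\overline{X[1]}$. For strings $a,b$, $a*b$ is the set of strings beginning with $a$ and ending with $b$. Gadgets: $I_L(0)=(010^3)^{55}$, $I_L(1)=(010^5)^{54}$, $I_L(2)=(010^7)^{53}$, $P_L=(010^9)^{144}$, $\mathrm{Sync}_L=01$, $I_R(\alpha)=\overleftarrow{I_L(\alpha)}$, $P_R=\overleftarrow{P_L}$, $\mathrm{Sync}_R=\overline{010}$; $E_L(\alpha)=P_L\mathrm{Sync}_LI_L(\alpha)\mathrm{Sync}_L$, $E_R(\alpha)=\mathrm{Sync}_RI_R(\alpha)\mathrm{Sync}_RP_R$; $y=P_L\,\mathrm{Sync}_L\,01\,11\overline{11}\,\overline{10}\,\mathrm{Sync}_R\,P_R$, $x=E_L(S[1])\cdots E_L(S[|S|])\,y\,E_R(T[|T|])\cdots E_R(T[1])$. $G_x$: vertices are substrings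 $x[i..j]$ (identified by positions); edges from $x[i..j]$ to $x[i+\ell..j]$ and to $x[i..j-\ell]$ whenever $1\le\ell\le\lfloor(j-i+1)/2\rfloor$ and $x[i..i+\ell-1]=\overleftarrow{x[j-\ell+1..j]}$. A path from $x$ to $y$ is a path from $x[1..|x|]$ to the occurrence of $y$ in $x$ between the $E_L$ blocks and the $E_R$ blocks. -}

module Defs where

open import Data.Bool using (Bool; true; false; not)
open import Data.Nat using (ℕ; zero; suc; _+_; _∸_; _≤_; _<_; _/_)
open import Data.Fin using (Fin; zero; suc)
open import Data.List using (List; []; _∷_; _++_; map; reverse; replicate; concat; concatMap; take; drop; length)
open import Data.Product using (_×_; _,_; ∃)
open import Data.Sum using (_⊎_)
open import Relation.Binary.PropositionalEquality using (_≡_)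

-- Binary strings: 0 = false, 1 = true
Str : Set
Str = List Bool

b0 b1 : Bool
b0 = false
b1 = true

compl : Str → Str
compl = map not

rc : Str → Str
rc X = reverse (compl X)

rep : ℕ → Str → Str
rep n w = concat (replicate n w)

zeros : ℕ → Str
zeros k = replicate k b0

IL : Fin 3 → Str
IL zero             = rep 55 (b0 ∷ b1 ∷ zeros 3)
IL (suc zero)       = rep 54 (b0 ∷ b1 ∷ zeros 5)
IL (suc (suc zero)) = rep 53 (b0 ∷ b1 ∷ zeros 7)

PL : Str
PL = rep 144 (b0 ∷ b1 ∷ zeros 9)

SyncL : Str
SyncL = b0 ∷ b1 ∷ []

IR : Fin 3 → Str
IR α = rc (IL α)

PR : Str
PR = rc PL

SyncR : Str
SyncR = compl (b0 ∷ b1 ∷ b0 ∷ [])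

EL : Fin 3 → Str
EL α = PL ++ SyncL ++ IL α ++ SyncL

ER : Fin 3 → Str
ER α = SyncR ++ IR α ++ SyncR ++ PR

yStr : Str
yStr = PL ++ SyncL ++ (b0 ∷ b1 ∷ []) ++ (b1 ∷ b1 ∷ [])
       ++ compl (b1 ∷ b1 ∷ []) ++ compl (b1 ∷ b0 ∷ []) ++ SyncR ++ PR

xLeft : List (Fin 3) → Str
xLeft S = concatMap EL S

xStr : List (Fin 3) → List (Fin 3) → Str
xStr S T = xLeft S ++ yStr ++ concatMap ER (reverse T)

-- the occurrence of y in x (1-indexed, inclusive): x[yStart..yEnd]
yStart : List (Fin 3) → ℕ
yStart S = suc (length (xLeft S))

yEnd : List (Fin 3) → ℕ
yEnd S = length (xLeft S) + length yStr

-- 1-indexed substring x[i..j] (inclusive)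
sub : Str → ℕ → ℕ → Str
sub x i j = take (suc j ∸ i) (drop (i ∸ 1) x)

-- vertices of G_x: position pairs (i , j) with 1 ≤ i ≤ j ≤ |x|
Vertex : Set
Vertex = ℕ × ℕ

Valid : Str → Vertex → Set
Valid x (i , j) = (1 ≤ i) × (i ≤ j) × (j ≤ length x)

data Edge (x : Str) : Vertex → Vertex → Set where
  cutLeft  : ∀ {i j ℓ} → Valid x (i , j) → 1 ≤ ℓ → ℓ ≤ (suc j ∸ i) / 2 →
             sub x i (i + ℓ ∸ 1) ≡ rc (sub x (suc j ∸ ℓ) j) →
             Edge x (i , j) (i + ℓ , j)
  cutRight : ∀ {i j ℓ} → Valid x (i , j) → 1 ≤ ℓ → ℓ ≤ (suc j ∸ i) / 2 →
             sub x i (i + ℓ ∸ 1) ≡ rc (sub x (suc j ∸ ℓ) j) →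
             Edge x (i , j) (i , j ∸ ℓ)

data Path (x : Str) : Vertex → Vertex → Set where
  stop : ∀ {v} → Valid x v → Path x v v
  step : ∀ {u v w} → Edge x u v → Path x v w → Path x u w

Visits : ∀ {x u v} → Path x u v → Vertex → Set
Visits {u = u} (stop _)   w = w ≡ u
Visits {u = u} (step _ p) w = (w ≡ u) ⊎ Visits p w

-- a * b : strings beginning with a and ending with b
InStar : Str → Str → Str → Set
InStar a b w = (∃ λ u → w ≡ a ++ u) × (∃ λ v → w ≡ v ++ b)

compl10k : ℕ → Str
compl10k k = compl (b1 ∷ zeros k)

zeros1 : ℕ → Str
zeros1 k = zeros k ++ (b1 ∷ [])

-- Every edge of G_x removes a prefix that is the reversed complement of a suffix, so
-- the outer characters of the vertex it leaves are complementary and, if it removes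
-- at least 2 characters, so are the second and second-to-last ones. Since y begins
-- with 0 and ends with 1, no path to y starts at a vertex whose outer characters agree.
-- At a vertex 01…11 only cuts of length 1 are possible, and the left one leads to such a
-- dead end 1…1; so the path cuts one character on the right, and keeps doing so while
-- the suffix of 1s lasts. Symmetrically, at 00…01 it cuts one character on the left.
module Submission where

open import Defs
open import Data.Bool using (Bool; true; false; not)
open import Data.Bool.Properties using (not-¬)
open import Data.Empty using (⊥-elim)
open import Data.Fin using (Fin)
open import Data.List using (List; []; _∷_; length; _++_; _∷ʳ_; concatMap; map; reverse; replicate; take; drop; head)
open import Data.List.Properties using (map-++; reverse-++; ∷-injective; ∷ʳ-injective; map-replicate; ++-assoc; drop-drop; length-drop)
open import Data.Maybe using (fromMaybe)
open import Data.Nat using (ℕ; zero; suc; _≤_; _<_; _+_; _∸_; _*_; _/_; z≤n; s≤s)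
open import Data.Nat.DivMod using (m/n*n≤m)
open import Data.Nat.Properties
open import Data.Product using (_×_; _,_; proj₁; proj₂)
open import Data.Sum using (_⊎_; inj₁; inj₂)
open import Relation.Binary.PropositionalEquality
open import Relation.Nullary using (¬_; yes; no)

-- The character x[n], 1-indexed; positions outside [1..|x|] give the junk value false.
at : Str → ℕ → Bool
at x n = fromMaybe false (head (drop (n ∸ 1) x))

take-suc-∷ʳ : ∀ {A : Set} (ys : List A) n (d : A) → n < length ys →
              take (suc n) ys ≡ take n ys ∷ʳ fromMaybe d (head (drop n ys))
take-suc-∷ʳ (y ∷ ys) zero    d _         = refl
take-suc-∷ʳ (y ∷ ys) (suc n) d (s≤s n<) = cong (y ∷_) (take-suc-∷ʳ ys n d n<)

drop-length-++ : ∀ {A : Set} (u v : List A) → drop (length u) (u ++ v) ≡ v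
drop-length-++ []      v = refl
drop-length-++ (_ ∷ u) v = drop-length-++ u v

take-length-++ : ∀ {A : Set} (u v : List A) → take (length u) (u ++ v) ≡ u
take-length-++ []      v = refl
take-length-++ (a ∷ u) v = cong (a ∷_) (take-length-++ u v)

rc-∷ʳ : ∀ (w : Str) a → rc (w ∷ʳ a) ≡ not a ∷ rc w
rc-∷ʳ w a rewrite map-++ not w (a ∷ []) | reverse-++ (map not w) (not a ∷ []) = refl

take-suc-drop : ∀ (x : Str) i n → i < length x →
                take (suc n) (drop i x) ≡ at x (suc i) ∷ take n (drop (suc i) x)
take-suc-drop (a ∷ x) zero    n _         = refl
take-suc-drop (a ∷ x) (suc i) n (s≤s i<) = take-suc-drop x i n i<

replicate-suc-∷ʳ : ∀ {A : Set} n (a : A) → replicate (suc n) a ≡ replicate n a ∷ʳ a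
replicate-suc-∷ʳ zero    a = refl
replicate-suc-∷ʳ (suc n) a = cong (a ∷_) (replicate-suc-∷ʳ n a)

sub-empty : ∀ x {i j} → j < i → sub x i j ≡ []
sub-empty x j<i rewrite m≤n⇒m∸n≡0 j<i = refl

sub-cons : ∀ x {i j} → 1 ≤ i → i ≤ j → i ≤ length x → sub x i j ≡ at x i ∷ sub x (suc i) j
sub-cons x {suc i} {suc j} _ (s≤s i≤j) i<∣x∣ rewrite +-∸-assoc 1 i≤j = take-suc-drop x i (j ∸ i) i<∣x∣

sub-snoc : ∀ x {i j} → 1 ≤ i → i ≤ j → j ≤ length x → sub x i j ≡ sub x i (j ∸ 1) ∷ʳ at x j
sub-snoc x {suc i} {suc j} _ (s≤s i≤j) j≤∣x∣ rewrite +-∸-assoc 1 i≤j =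
  begin
    take (suc (j ∸ i)) (drop i x)
  ≡⟨ take-suc-∷ʳ (drop i x) (j ∸ i) false j∸i<∣drop∣ ⟩
    take (j ∸ i) (drop i x) ∷ʳ fromMaybe false (head (drop (j ∸ i) (drop i x)))
  ≡⟨ cong (λ d → take (j ∸ i) (drop i x) ∷ʳ fromMaybe false (head d))
          (trans (drop-drop i (j ∸ i) x) (cong (λ n → drop n x) (m+[n∸m]≡n i≤j))) ⟩
    take (j ∸ i) (drop i x) ∷ʳ at x (suc j)
  ∎
  where
  open ≡-Reasoning
  j∸i<∣drop∣ : j ∸ i < length (drop i x)
  j∸i<∣drop∣ rewrite length-drop i x = ∸-monoˡ-< j≤∣x∣ i≤j

sub-∷ : ∀ x {i j a r} → 1 ≤ i → j ≤ length x → sub x i j ≡ a ∷ r →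
        at x i ≡ a × sub x (suc i) j ≡ r
sub-∷ x {i} {j} 1≤i j≤∣x∣ eq with i ≤? j
... | yes i≤j = ∷-injective (trans (sym (sub-cons x 1≤i i≤j (≤-trans i≤j j≤∣x∣))) eq)
... | no i≰j with () ← trans (sym (sub-empty x (≰⇒> i≰j))) eq

sub-∷ʳ : ∀ x {i j a} r → 1 ≤ i → j ≤ length x → sub x i j ≡ r ∷ʳ a →
         at x j ≡ a × sub x i (j ∸ 1) ≡ r
sub-∷ʳ x {i} {j} r 1≤i j≤∣x∣ eq with i ≤? j
... | yes i≤j = let r≡ , a≡ = ∷ʳ-injective _ r (trans (sym (sub-snoc x 1≤i i≤j j≤∣x∣)) eq) in a≡ , r≡
... | no i≰j = ⊥-elim (nonempty r (trans (sym (sub-empty x (≰⇒> i≰j))) eq))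
  where
  nonempty : ∀ {a} (r : Str) → ¬ ([] ≡ r ∷ʳ a)
  nonempty []      ()
  nonempty (_ ∷ _) ()

sub-replicate-++ : ∀ x {i j a} n r → 1 ≤ i → j ≤ length x → sub x i j ≡ replicate n a ++ r →
                   ∀ t → t < n → at x (t + i) ≡ a
sub-replicate-++ x zero r _ _ _ t ()
sub-replicate-++ x {i} {a = a} (suc n) r 1≤i j≤∣x∣ eq t t<n with sub-∷ x 1≤i j≤∣x∣ eq | t
... | x[i]≡a , _   | zero   = x[i]≡a
... | _      , eq′ | suc t′ = subst (λ k → at x k ≡ a) (+-suc t′ i)
                                (sub-replicate-++ x n r (s≤s z≤n) j≤∣x∣ eq′ t′ (≤-pred t<n))

++-replicate : ∀ x {i j a} n r → 1 ≤ i → j ≤ length x → sub x i j ≡ r ++ replicate n a →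
               ∀ t → t < n → at x (j ∸ t) ≡ a
++-replicate x zero r _ _ _ t ()
++-replicate x {i} {j} {a} (suc n) r 1≤i j≤∣x∣ eq t t<n
  with sub-∷ʳ x (r ++ replicate n a) 1≤i j≤∣x∣
         (trans eq (trans (cong (r ++_) (replicate-suc-∷ʳ n a)) (sym (++-assoc r (replicate n a) (a ∷ [])))))
     | t
... | x[j]≡a , _   | zero   = x[j]≡a
... | _      , eq′ | suc t′ = subst (λ k → at x k ≡ a) (∸-+-assoc j 1 t′)
                                (++-replicate x {i} n r 1≤i (≤-trans (m∸n≤m j 1) j≤∣x∣) eq′ t′ (≤-pred t<n))

sub-starts-01 : ∀ x {i j u} → 1 ≤ i → j ≤ length x → sub x i j ≡ b0 ∷ b1 ∷ u →
                at x i ≡ false × at x (suc i) ≡ true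
sub-starts-01 x {i} 1≤i j≤∣x∣ eq =
  let x[i] , eq′ = sub-∷ x 1≤i j≤∣x∣ eq in x[i] , proj₁ (sub-∷ x {suc i} (s≤s z≤n) j≤∣x∣ eq′)

sub-ends-01 : ∀ x {i j} v → 1 ≤ i → j ≤ length x → sub x i j ≡ v ++ b0 ∷ b1 ∷ [] →
              at x (j ∸ 1) ≡ false × at x j ≡ true
sub-ends-01 x {j = j} v 1≤i j≤∣x∣ eq =
  let x[j] , eq′ = sub-∷ʳ x (v ∷ʳ b0) 1≤i j≤∣x∣ (trans eq (sym (++-assoc v (b0 ∷ []) (b1 ∷ []))))
  in proj₁ (sub-∷ʳ x v 1≤i (≤-trans (m∸n≤m j 1) j≤∣x∣) eq′) , x[j]

sub-infix : ∀ (u w v : Str) → sub (u ++ w ++ v) (suc (length u)) (length u + length w) ≡ w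
sub-infix u w v rewrite m+n∸m≡n (length u) (length w) | drop-length-++ u (w ++ v) = take-length-++ w v

mirror-peel : ∀ {x : Str} {i j} m → 1 ≤ i → suc j ≤ length x → suc m + suc m + i ≤ suc (suc j) →
              sub x i (i + suc m ∸ 1) ≡ rc (sub x (suc (suc j) ∸ suc m) (suc j)) →
              at x i ≡ not (at x (suc j)) × sub x (suc i) (i + m) ≡ rc (sub x (suc j ∸ m) j)
mirror-peel {x} {i} {j} m 1≤i j<∣x∣ (s≤s bound) mirror = ∷-injective (begin
    at x i ∷ sub x (suc i) (i + m)
  ≡⟨ sym (sub-cons x 1≤i (m≤m+n i m) (≤-trans i≤j+1 j<∣x∣)) ⟩
    sub x i (i + m)
  ≡⟨ cong (λ k → sub x i (k ∸ 1)) (sym (+-suc i m)) ⟩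
    sub x i (i + suc m ∸ 1)
  ≡⟨ mirror ⟩
    rc (sub x (suc j ∸ m) (suc j))
  ≡⟨ cong rc (sub-snoc x (m<n⇒0<n∸m m<j+1) (m∸n≤m (suc j) m) j<∣x∣) ⟩
    rc (sub x (suc j ∸ m) j ∷ʳ at x (suc j))
  ≡⟨ rc-∷ʳ (sub x (suc j ∸ m) j) (at x (suc j)) ⟩
    not (at x (suc j)) ∷ rc (sub x (suc j ∸ m) j)
  ∎)
  where
  open ≡-Reasoning
  m<j+1 : m < suc j
  m<j+1 = ≤-trans (≤-trans (m≤n+m (suc m) m) (m≤m+n _ i)) bound
  i≤j+1 : i ≤ suc j
  i≤j+1 = ≤-trans (m≤n+m i (m + suc m)) bound

mirror-complement : ∀ {x : Str} {i j} ℓ → 1 ≤ i → j ≤ length x → ℓ + ℓ + i ≤ suc j →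
                    sub x i (i + ℓ ∸ 1) ≡ rc (sub x (suc j ∸ ℓ) j) →
                    ∀ t → t < ℓ → at x (t + i) ≡ not (at x (j ∸ t))
mirror-complement zero _ _ _ _ t ()
mirror-complement {i = i} {zero} (suc m) _ _ (s≤s bound)
  with () ← ≤-trans (≤-trans (m≤n+m (suc m) m) (m≤m+n _ i)) bound
mirror-complement {j = suc j} (suc m) 1≤i j<∣x∣ bound mirror zero _ =
  proj₁ (mirror-peel m 1≤i j<∣x∣ bound mirror)
mirror-complement {x} {i} {suc j} (suc m) 1≤i j<∣x∣ (s≤s bound) mirror (suc t) t<ℓ =
  subst (λ k → at x k ≡ not (at x (j ∸ t))) (+-suc t i)
    (mirror-complement m (s≤s z≤n) (≤-trans (n≤1+n j) j<∣x∣) bound′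
      (proj₂ (mirror-peel m 1≤i j<∣x∣ (s≤s bound) mirror)) t (≤-pred t<ℓ))
  where
  bound′ : m + m + suc i ≤ suc j
  bound′ = subst (_≤ suc j) (trans (cong (_+ i) (+-suc m m)) (sym (+-suc (m + m) i))) bound

half-bound : ∀ {i j ℓ} → i ≤ j → ℓ ≤ (suc j ∸ i) / 2 → ℓ + ℓ + i ≤ suc j
half-bound {i} {j} {ℓ} i≤j ℓ≤half = begin
    ℓ + ℓ + i
  ≤⟨ +-monoˡ-≤ i (+-mono-≤ ℓ≤half ℓ≤half) ⟩
    h + h + i
  ≡⟨ cong (λ k → k + i) (sym h*2≡h+h) ⟩
    h * 2 + i
  ≤⟨ +-monoˡ-≤ i (m/n*n≤m (suc j ∸ i) 2) ⟩
    suc j ∸ i + i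
  ≡⟨ m∸n+n≡m (≤-trans i≤j (n≤1+n j)) ⟩
    suc j
  ∎
  where
  open ≤-Reasoning
  h : ℕ
  h = (suc j ∸ i) / 2
  h*2≡h+h : h * 2 ≡ h + h
  h*2≡h+h = trans (*-comm h 2) (cong (h +_) (+-identityʳ h))

edge-mirror : ∀ {x i j ℓ} → Valid x (i , j) → ℓ ≤ (suc j ∸ i) / 2 →
              sub x i (i + ℓ ∸ 1) ≡ rc (sub x (suc j ∸ ℓ) j) →
              ∀ t → t < ℓ → at x (t + i) ≡ not (at x (j ∸ t))
edge-mirror {ℓ = ℓ} (1≤i , i≤j , j≤∣x∣) ℓ≤half = mirror-complement ℓ 1≤i j≤∣x∣ (half-bound i≤j ℓ≤half)

edge-ends-complementary : ∀ {x i j w} → Edge x (i , j) w → at x i ≡ not (at x j)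
edge-ends-complementary (cutLeft  val 1≤ℓ ℓ≤half mirror) = edge-mirror val ℓ≤half mirror 0 1≤ℓ
edge-ends-complementary (cutRight val 1≤ℓ ℓ≤half mirror) = edge-mirror val ℓ≤half mirror 0 1≤ℓ

edge-unit-if-inner-equal : ∀ {x i j w} → Edge x (i , j) w → at x (suc i) ≡ at x (j ∸ 1) →
                           w ≡ (suc i , j) ⊎ w ≡ (i , j ∸ 1)
edge-unit-if-inner-equal {i = i} {j} (cutLeft {ℓ = 1} _ _ _ _) _ = inj₁ (cong (_, j) (+-comm i 1))
edge-unit-if-inner-equal (cutRight {ℓ = 1} _ _ _ _) _ = inj₂ refl
edge-unit-if-inner-equal (cutLeft {ℓ = suc (suc _)} val _ ℓ≤half mirror) inner =
  ⊥-elim (not-¬ inner (edge-mirror val ℓ≤half mirror 1 (s≤s (s≤s z≤n))))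
edge-unit-if-inner-equal (cutRight {ℓ = suc (suc _)} val _ ℓ≤half mirror) inner =
  ⊥-elim (not-¬ inner (edge-mirror val ℓ≤half mirror 1 (s≤s (s≤s z≤n))))

visits-source : ∀ {x u v} (q : Path x u v) → Visits q u
visits-source (stop _)   = refl
visits-source (step _ _) = inj₁ refl

visits-valid : ∀ {x u v w} (p : Path x u v) → Visits p w → Valid x w
visits-valid (stop val)                    refl        = val
visits-valid (step (cutLeft  val _ _ _) _) (inj₁ refl) = val
visits-valid (step (cutRight val _ _ _) _) (inj₁ refl) = val
visits-valid (step _ p)                    (inj₂ vis)  = visits-valid p vis

visits-forced : ∀ {x u v w w′} → (∀ (q : Path x w v) → Visits q w′) →
                (p : Path x u v) → Visits p w → Visits p w′
visits-forced forced (stop val)  refl        = forced (stop val)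
visits-forced forced (step e p)  (inj₁ refl) = forced (step e p)
visits-forced forced (step _ p)  (inj₂ vis)  = inj₂ (visits-forced forced p vis)

module Framed {x : Str} {s e : ℕ} (valid : Valid x (s , e))
         (framed : InStar (b0 ∷ b1 ∷ []) (b0 ∷ b1 ∷ []) (sub x s e)) where

  private
    starts : at x s ≡ false × at x (suc s) ≡ true
    starts = let (u , eq) , _ = framed in sub-starts-01 x (proj₁ valid) (proj₂ (proj₂ valid)) eq
    ends : at x (e ∸ 1) ≡ false × at x e ≡ true
    ends = let _ , (v , eq) = framed in sub-ends-01 x v (proj₁ valid) (proj₂ (proj₂ valid)) eq

  equal-ends-unreachable : ∀ {i j} → at x i ≡ at x j → ¬ Path x (i , j) (s , e)
  equal-ends-unreachable same (stop _)      with () ← trans (sym (proj₁ starts)) (trans same (proj₂ ends))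
  equal-ends-unreachable same (step edge _) = not-¬ same (edge-ends-complementary edge)

  right-cut-forced : ∀ {i j} → at x (suc i) ≡ true → at x (j ∸ 1) ≡ true → at x j ≡ true →
                     (q : Path x (i , j) (s , e)) → Visits q (i , j ∸ 1)
  right-cut-forced _ x[j-1] _ (stop _) with () ← trans (sym x[j-1]) (proj₁ ends)
  right-cut-forced x[i+1] x[j-1] x[j] (step edge q) with edge-unit-if-inner-equal edge (trans x[i+1] (sym x[j-1]))
  ... | inj₁ refl = ⊥-elim (equal-ends-unreachable (trans x[i+1] (sym x[j])) q)
  ... | inj₂ refl = inj₂ (visits-source q)

  left-cut-forced : ∀ {i j} → at x i ≡ false → at x (suc i) ≡ false → at x (j ∸ 1) ≡ false →
                    (q : Path x (i , j) (s , e)) → Visits q (suc i , j)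
  left-cut-forced _ x[i+1] _ (stop _) with () ← trans (sym (proj₂ starts)) x[i+1]
  left-cut-forced x[i] x[i+1] x[j-1] (step edge q) with edge-unit-if-inner-equal edge (trans x[i+1] (sym x[j-1]))
  ... | inj₁ refl = inj₂ (visits-source q)
  ... | inj₂ refl = ⊥-elim (equal-ends-unreachable (trans x[i] (sym x[j-1])) q)

  visits-right-cuts : ∀ {u i j k} (p : Path x u (s , e)) → Visits p (i , j) → at x (suc i) ≡ true →
                      (∀ t → t < k → at x (j ∸ t) ≡ true) → ∀ m → m < k → Visits p (i , j ∸ m)
  visits-right-cuts p vis _ _ zero _ = vis
  visits-right-cuts {i = i} {j} {suc k} p vis x[i+1] ones (suc m) (s≤s m<k) =
    subst (λ n → Visits p (i , n)) (∸-+-assoc j 1 m)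
      (visits-right-cuts p (visits-forced cut p vis) x[i+1] ones′ m m<k)
    where
    cut : (q : Path x (i , j) (s , e)) → Visits q (i , j ∸ 1)
    cut = right-cut-forced x[i+1] (ones 1 (s≤s (≤-trans (s≤s z≤n) m<k))) (ones 0 (s≤s z≤n))
    ones′ : ∀ t → t < k → at x (j ∸ 1 ∸ t) ≡ true
    ones′ t t<k = subst (λ n → at x n ≡ true) (sym (∸-+-assoc j 1 t)) (ones (suc t) (s≤s t<k))

  visits-left-cuts : ∀ {u i j k} (p : Path x u (s , e)) → Visits p (i , j) → at x (j ∸ 1) ≡ false →
                     (∀ t → t < k → at x (t + i) ≡ false) → ∀ m → m < k → Visits p (m + i , j)
  visits-left-cuts p vis _ _ zero _ = vis
  visits-left-cuts p vis x[j-1] zeros (suc m) m+1<k =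
    visits-forced (left-cut-forced (zeros m (<⇒≤ m+1<k)) (zeros (suc m) m+1<k) x[j-1]) p
      (visits-left-cuts p vis x[j-1] zeros m (<⇒≤ m+1<k))

target-framed : ∀ S T → InStar (b0 ∷ b1 ∷ []) (b0 ∷ b1 ∷ []) (sub (xStr S T) (yStart S) (yEnd S))
target-framed S T rewrite sub-infix (xLeft S) yStr (concatMap ER (reverse T)) =
  (drop 2 yStr , refl) , (take (length yStr ∸ 2) yStr , refl)

path-target-valid : ∀ {x u v} → Path x u v → Valid x v
path-target-valid (stop val) = val
path-target-valid (step _ p) = path-target-valid p

lemma15 : (S T : List (Fin 3)) →
    (p : Path (xStr S T) (1 , length (xStr S T)) (yStart S , yEnd S)) →
    ((i j k : ℕ) → 1 ≤ k → Visits p (i , j) →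
    InStar (b0 ∷ b1 ∷ []) (compl10k k) (sub (xStr S T) i j) →
    (k' : ℕ) → 1 ≤ k' → k' < k → Visits p (i , j ∸ k'))
    ×
    ((i j k : ℕ) → 1 ≤ k → Visits p (i , j) →
    InStar (zeros1 k) (compl (b1 ∷ b0 ∷ [])) (sub (xStr S T) i j) →
    (k' : ℕ) → 1 ≤ k' → k' < k → Visits p (i + k' , j))
lemma15 S T p = right-cuts , left-cuts
  where
  open Framed (path-target-valid p) (target-framed S T)
  x : Str
  x = xStr S T

  right-cuts : (i j k : ℕ) → 1 ≤ k → Visits p (i , j) →
               InStar (b0 ∷ b1 ∷ []) (compl10k k) (sub x i j) →
               (k' : ℕ) → 1 ≤ k' → k' < k → Visits p (i , j ∸ k')
  right-cuts i j k _ vis ((u , pre) , (v , suf)) k' _ k'<k =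
    let 1≤i , _ , j≤∣x∣ = visits-valid p vis
        suf′ = trans suf (trans (cong (λ w → v ++ b0 ∷ w) (map-replicate not k b0))
                                (sym (++-assoc v (b0 ∷ []) (replicate k b1))))
    in visits-right-cuts p vis (proj₂ (sub-starts-01 x 1≤i j≤∣x∣ pre))
         (++-replicate x k (v ∷ʳ b0) 1≤i j≤∣x∣ suf′) k' k'<k

  left-cuts : (i j k : ℕ) → 1 ≤ k → Visits p (i , j) →
              InStar (zeros1 k) (compl (b1 ∷ b0 ∷ [])) (sub x i j) →
              (k' : ℕ) → 1 ≤ k' → k' < k → Visits p (i + k' , j)
  left-cuts i j k _ vis ((u , pre) , (v , suf)) k' _ k'<k =
    let 1≤i , _ , j≤∣x∣ = visits-valid p vis
        pre′ = trans pre (++-assoc (replicate k b0) (b1 ∷ []) u)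
    in subst (λ n → Visits p (n , j)) (+-comm k' i)
         (visits-left-cuts p vis (proj₁ (sub-ends-01 x v 1≤i j≤∣x∣ suf))
           (sub-replicate-++ x k (b1 ∷ u) 1≤i j≤∣x∣ pre′) k' k'<k)
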